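{- (One vs. All.) For every $\varepsilon > 0$ there is a constant $C_\varepsilon$ (depending only on $\varepsilon$) such that for every $n \ge 1$ and every $w \in \{0,1\}^n$ there is a first-order $\tau_{\mathsf{string}}$-sentence, true in $\mathbf{B}_w$ and false in $\mathbf{B}_{w'}$ for every $w' \in \{0,1\}^n\setminus\{w\}$, with at most $(1+\varepsilon)\log(n) + C_\varepsilon$ quantifiers. Moreover, this sentence in prenex form has a quantifier prefix that starts with $\forall$, then has at most $\varepsilon\log(n)+1$ occurrences of $\exists$, and then ends with a strictly alternating quantifier sequence of length at most $\log(n) + C_\varepsilon$.
   Context: $\tau_{\mathsf{string}} = \langle <, S; \mathsf{min}, \mathsf{max}\rangle$ with $<$ binary, $S$ unary, $\mathsf{min},\mathsf{max}$ constants. A string $w = w_1\cdots w_n \in \{0,1\}^n$ is encoded by the structure $\mathbf{B}_w$ with universe $\{1,\dots,n\}$, $<$ the usual order, $S = \{i : w_i = 1\}$, $\mathsf{min}=1$, $\mathsf{max}=n$. The number of quantifiers of a sentence is the number of quantifier occurrences. $\log$ is base 2.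
   Formalization: The parameter ε ranges over the positive rationals. -}

module Defs where

open import Data.Nat using (ℕ; zero; suc; _+_; _*_; _∸_; _^_; _≤_)
open import Data.Fin using (Fin; zero; suc; toℕ; fromℕ)
import Data.Fin as F
open import Data.Bool using (Bool; true)
open import Data.Vec using (Vec; lookup)
open import Data.List using (List; []; _∷_; length; _++_)
open import Data.List.Relation.Unary.All using (All)
open import Data.Product using (_×_)
open import Data.Sum using (_⊎_)
open import Relation.Binary.PropositionalEquality using (_≡_; _≢_)
open import Relation.Nullary using (¬_)

-- First-order logic over τ_string = ⟨ <, S ; min, max ⟩, de Bruijn variables.
-- Formula k : formulas with (at most) k free variables; sentences = Formula 0.

data Term (k : ℕ) : Set where
  var  : Fin k → Term k
  mn   : Term k
  mx   : Term k

data Formula : ℕ → Set where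
  _≐_  : ∀ {k} → Term k → Term k → Formula k
  _≺_  : ∀ {k} → Term k → Term k → Formula k
  S    : ∀ {k} → Term k → Formula k
  ¬'_  : ∀ {k} → Formula k → Formula k
  _∧'_ : ∀ {k} → Formula k → Formula k → Formula k
  _∨'_ : ∀ {k} → Formula k → Formula k → Formula k
  ∀'   : ∀ {k} → Formula (suc k) → Formula k
  ∃'   : ∀ {k} → Formula (suc k) → Formula k

Sentence : Set
Sentence = Formula 0

-- number of quantifier occurrences
qr : ∀ {k} → Formula k → ℕ
qr (t ≐ u)   = 0
qr (t ≺ u)   = 0
qr (S t)     = 0
qr (¬' φ)    = qr φ
qr (φ ∧' ψ)  = qr φ + qr ψ
qr (φ ∨' ψ)  = qr φ + qr ψ
qr (∀' φ)    = suc (qr φ)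
qr (∃' φ)    = suc (qr φ)

-- Semantics in B_w for w ∈ {0,1}^n, n = suc m.  Universe {1,…,n} is
-- represented by Fin n (position i ↦ Fin element i-1), so min = zero,
-- max = fromℕ m, < is the usual order, S = {i : w_i = 1} (1 = true).

ext : ∀ {k N} → (Fin k → Fin N) → Fin N → Fin (suc k) → Fin N
ext ρ x zero    = x
ext ρ x (suc i) = ρ i

evalT : ∀ {m k} → (Fin k → Fin (suc m)) → Term k → Fin (suc m)
evalT ρ (var i) = ρ i
evalT ρ mn      = zero
evalT {m} ρ mx  = fromℕ m

Sat : ∀ {m k} → Vec Bool (suc m) → Formula k → (Fin k → Fin (suc m)) → Set
Sat w (t ≐ u)  ρ = evalT ρ t ≡ evalT ρ u
Sat w (t ≺ u)  ρ = evalT ρ t F.< evalT ρ u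
Sat w (S t)    ρ = lookup w (evalT ρ t) ≡ true
Sat w (¬' φ)   ρ = ¬ Sat w φ ρ
Sat w (φ ∧' ψ) ρ = Sat w φ ρ × Sat w ψ ρ
Sat w (φ ∨' ψ) ρ = Sat w φ ρ ⊎ Sat w ψ ρ
Sat w (∀' φ)   ρ = (x : Fin _) → Sat w φ (ext ρ x)
Sat w (∃' φ)   ρ = Data.Product.Σ (Fin _) (λ x → Sat w φ (ext ρ x))

noVars : ∀ {N} → Fin 0 → Fin N
noVars ()

_⊨_ : ∀ {m} → Vec Bool (suc m) → Sentence → Set
w ⊨ φ = Sat w φ noVars

data QF : ∀ {k} → Formula k → Set where
  qf≐ : ∀ {k} {t u : Term k} → QF (t ≐ u)
  qf≺ : ∀ {k} {t u : Term k} → QF (t ≺ u)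
  qfS : ∀ {k} {t : Term k} → QF (S t)
  qf¬ : ∀ {k} {φ : Formula k} → QF φ → QF (¬' φ)
  qf∧ : ∀ {k} {φ ψ : Formula k} → QF φ → QF ψ → QF (φ ∧' ψ)
  qf∨ : ∀ {k} {φ ψ : Formula k} → QF φ → QF ψ → QF (φ ∨' ψ)

data Prenex : ∀ {k} → Formula k → Set where
  matrix : ∀ {k} {φ : Formula k} → QF φ → Prenex φ
  p∀ : ∀ {k} {φ : Formula (suc k)} → Prenex φ → Prenex (∀' φ)
  p∃ : ∀ {k} {φ : Formula (suc k)} → Prenex φ → Prenex (∃' φ)

data Q : Set where
  ∀q ∃q : Q

prefix : ∀ {k} → Formula k → List Q
prefix (∀' φ) = ∀q ∷ prefix φ
prefix (∃' φ) = ∃q ∷ prefix φ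
prefix _      = []

data Alternating : List Q → Set where
  alt[]  : Alternating []
  alt[_] : ∀ q → Alternating (q ∷ [])
  alt∷   : ∀ {q r qs} → q ≢ r → Alternating (r ∷ qs) → Alternating (q ∷ r ∷ qs)

-- Real-valued bounds via exact integer encodings, for ε = a / b (a, b ≥ 1)
-- and n ≥ 1 (all with log base 2):
--   x ≤ (1 + a/b)·log n + C   ⇔   2^(b·(x ∸ C)) ≤ n^(a+b)
--   x ≤ (a/b)·log n + 1       ⇔   2^(b·(x ∸ 1)) ≤ n^a
--   x ≤ log n + C             ⇔   2^(x ∸ C) ≤ n
≤[1+ε]log+C : ℕ → ℕ → ℕ → ℕ → ℕ → Set
≤[1+ε]log+C a b n C x = 2 ^ (b * (x ∸ C)) ≤ n ^ (a + b)

≤εlog+1 : ℕ → ℕ → ℕ → ℕ → Set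
≤εlog+1 a b n x = 2 ^ (b * (x ∸ 1)) ≤ n ^ a

≤log+C : ℕ → ℕ → ℕ → Set
≤log+C n C x = 2 ^ (x ∸ C) ≤ n

-- The sentence has the form ∀x ∃v₁ … ∃v_N Q₁u₁ … Q_L u_L ψ with ψ quantifier-free. The values v
-- name the index i of x in base r + 1: d = log_{r+1} n digits, each read off as the number of the
-- r remaining values ("rulers") not exceeding it, so N = d + r. A case distinction over the digits
-- then demands that x carries the letter w_i and that x is the i-th element, i.e. min + i ≤ x and
-- x + (n - 1 - i) ≤ max. Such gap conditions p + A ≤ q are verified by a halving game in the
-- alternating block: ∀ attacks one of two gaps with a point, ∃ answers with a midpoint, so
-- L = log n + O(1). Positions of the game are leaves of quantifier-free decision trees, which
-- keeps the sentence prenex. For ε = (a + 1)/(b + 1) and r = 2^(2(b + 1)) + 1 we get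
-- N - 1 ≤ 2(d - 1) ≤ log n / (b + 1) ≤ ε log n once d > r; for smaller n the code quantifiers are
-- interleaved with dummy ∀s and absorbed into the constant.

module Submission where

open import Defs
open import Data.Nat using (ℕ; suc)
open import Data.Bool using (Bool)
open import Data.Vec using (Vec)
open import Data.List using (List; _∷_; _++_; length)
open import Data.List.Relation.Unary.All using (All)
open import Data.Product using (Σ; _×_; ∃-syntax)
open import Relation.Binary.PropositionalEquality using (_≡_; _≢_)
open import Relation.Nullary using (¬_)

open import Data.Nat
  using (zero; _+_; _*_; _∸_; _^_; _≤_; _<_; z≤n; s≤s; _≤?_; _<?_; _<ᵇ_; ⌊_/2⌋; ⌈_/2⌉; pred; NonZero; >-nonZero)
open import Data.Nat.Properties
open import Data.Nat.DivMod using (_/_; _%_; m≡m%n+[m/n]*n; m%n<n; m<n*o⇒m/o<n)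
open import Data.Nat.Tactic.RingSolver using (solve-∀)
open import Data.Fin using (Fin; zero; suc; toℕ; fromℕ<)
open import Data.Fin.Properties using (toℕ<n; toℕ-fromℕ<; toℕ-fromℕ; toℕ-injective; ¬∀⟶∃¬)
open import Data.Bool using (true; false; if_then_else_; T)
import Data.Bool.Properties as Bool
open import Data.Vec using (lookup)
open import Data.Vec.Properties using (tabulate∘lookup; tabulate-cong)
open import Data.List using ([]; map; take; drop; reverse; reverseAcc; replicate)
open import Data.List.Properties
  using (map-∘; map-cong; take-map; drop-map; length-map; length-++; length-reverse; reverse-involutive; length-replicate)
open import Data.List.Relation.Unary.All using ([]; _∷_)
import Data.List.Relation.Unary.All as All
import Data.List.Relation.Unary.All.Properties as All
open import Data.Product using (_,_; proj₁; proj₂)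
open import Data.Product.Function.NonDependent.Propositional using (_×-cong_)
open import Data.Sum using (_⊎_; inj₁; inj₂)
open import Data.Sum.Function.Propositional using (_⊎-cong_)
open import Data.Empty using (⊥)
open import Data.Unit using (⊤; tt)
open import Function using (id; _∘_; _⇔_; mk⇔; Equivalence)
open Equivalence using (to; from)
open import Relation.Binary.PropositionalEquality
  using (refl; sym; trans; cong; cong₂; subst; subst₂; module ≡-Reasoning)
open import Relation.Nullary using (Dec; yes; no; does; contradiction)
open import Relation.Nullary.Decidable using (dec-true; dec-false; _×-dec_)

-- Decision trees and positional games

data Guard (k : ℕ) : Set where
  _<ᵍ_ : Term k → Term k → Guard k
  Sᵍ   : Term k → Guard k

guardF : ∀ {k} → Guard k → Formula k
guardF (t <ᵍ u) = t ≺ u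
guardF (Sᵍ t)   = S t

data Tree (L : Set) (k : ℕ) : Set where
  leaf : L → Tree L k
  node : Guard k → Tree L k → Tree L k → Tree L k

treeF : ∀ {L k} → (L → Formula k) → Tree L k → Formula k
treeF f (leaf p)     = f p
treeF f (node g t e) = (guardF g ∧' treeF f t) ∨' ((¬' guardF g) ∧' treeF f e)

AllLeaves : ∀ {L k} → (L → Set) → Tree L k → Set
AllLeaves R (leaf p)     = R p
AllLeaves R (node _ t e) = AllLeaves R t × AllLeaves R e

wkT : ∀ {k} → Term k → Term (suc k)
wkT (var i) = var (suc i)
wkT mn      = mn
wkT mx      = mx

wkG : ∀ {k} → Guard k → Guard (suc k)
wkG (t <ᵍ u) = wkT t <ᵍ wkT u
wkG (Sᵍ t)   = Sᵍ (wkT t)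

graft : ∀ {L L′ k} → (L → Tree L′ (suc k)) → Tree L k → Tree L′ (suc k)
graft f (leaf p)     = f p
graft f (node g t e) = node (wkG g) (graft f t) (graft f e)

AllLeaves-graft : ∀ {L L′ k} {R : L → Set} {R′ : L′ → Set} (f : L → Tree L′ (suc k)) →
                  (∀ p → R p → AllLeaves R′ (f p)) → ∀ t → AllLeaves R t → AllLeaves R′ (graft f t)
AllLeaves-graft f hf (leaf p)     r         = hf p r
AllLeaves-graft f hf (node _ t e) (rt , re) = AllLeaves-graft f hf t rt , AllLeaves-graft f hf e re

QF⇒qr≡0 : ∀ {k} {φ : Formula k} → QF φ → qr φ ≡ 0
QF⇒qr≡0 qf≐         = refl
QF⇒qr≡0 qf≺         = refl
QF⇒qr≡0 qfS         = refl
QF⇒qr≡0 (qf¬ q)     = QF⇒qr≡0 q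
QF⇒qr≡0 (qf∧ q₁ q₂) = cong₂ _+_ (QF⇒qr≡0 q₁) (QF⇒qr≡0 q₂)
QF⇒qr≡0 (qf∨ q₁ q₂) = cong₂ _+_ (QF⇒qr≡0 q₁) (QF⇒qr≡0 q₂)

QF⇒prefix≡[] : ∀ {k} {φ : Formula k} → QF φ → prefix φ ≡ []
QF⇒prefix≡[] qf≐       = refl
QF⇒prefix≡[] qf≺       = refl
QF⇒prefix≡[] qfS       = refl
QF⇒prefix≡[] (qf¬ _)   = refl
QF⇒prefix≡[] (qf∧ _ _) = refl
QF⇒prefix≡[] (qf∨ _ _) = refl

treeF-QF : ∀ {L k} {f : L → Formula k} → (∀ p → QF (f p)) → (t : Tree L k) → QF (treeF f t)
treeF-QF qf (leaf p)     = qf p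
treeF-QF qf (node g t e) = qf∨ (qf∧ (guard-QF g) (treeF-QF qf t)) (qf∧ (qf¬ (guard-QF g)) (treeF-QF qf e))
  where
  guard-QF : ∀ {k} (g : Guard k) → QF (guardF g)
  guard-QF (_ <ᵍ _) = qf≺
  guard-QF (Sᵍ _)   = qfS

module Game {P : ℕ → Set} (leafF : ∀ {k} → P k → Formula k)
            (moveA moveE : ∀ {k} → P k → Tree (P (suc k)) (suc k)) where

  game : ∀ {k} → List Q → Tree (P k) k → Formula k
  game []         t = treeF leafF t
  game (∀q ∷ qs) t = ∀' (game qs (graft moveA t))
  game (∃q ∷ qs) t = ∃' (game qs (graft moveE t))

  module _ (leafF-QF : ∀ {k} (p : P k) → QF (leafF p)) where

    prefix-game : ∀ {k} qs (t : Tree (P k) k) → prefix (game qs t) ≡ qs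
    prefix-game []         t = QF⇒prefix≡[] (treeF-QF leafF-QF t)
    prefix-game (∀q ∷ qs) t = cong (∀q ∷_) (prefix-game qs _)
    prefix-game (∃q ∷ qs) t = cong (∃q ∷_) (prefix-game qs _)

    prenex-game : ∀ {k} qs (t : Tree (P k) k) → Prenex (game qs t)
    prenex-game []         t = matrix (treeF-QF leafF-QF t)
    prenex-game (∀q ∷ qs) t = p∀ (prenex-game qs _)
    prenex-game (∃q ∷ qs) t = p∃ (prenex-game qs _)

    qr-game : ∀ {k} qs (t : Tree (P k) k) → qr (game qs t) ≡ length qs
    qr-game []         t = QF⇒qr≡0 (treeF-QF leafF-QF t)
    qr-game (∀q ∷ qs) t = cong suc (qr-game qs _)
    qr-game (∃q ∷ qs) t = cong suc (qr-game qs _)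

module Semantics {m : ℕ} (w′ : Vec Bool (suc m)) where

  Env : ℕ → Set
  Env k = Fin k → Fin (suc m)

  val : ∀ {k} → Env k → Term k → ℕ
  val σ t = toℕ (evalT σ t)

  evalT-wk : ∀ {k} (ρ : Env k) u t → evalT (ext ρ u) (wkT t) ≡ evalT ρ t
  evalT-wk ρ u (var i) = refl
  evalT-wk ρ u mn      = refl
  evalT-wk ρ u mx      = refl

  val-wk : ∀ {k} (ρ : Env k) u t → val (ext ρ u) (wkT t) ≡ val ρ t
  val-wk ρ u t = cong toℕ (evalT-wk ρ u t)

  map-evalT-wk : ∀ {k} (ρ : Env k) u ts → map (evalT (ext ρ u)) (map wkT ts) ≡ map (evalT ρ) ts
  map-evalT-wk ρ u ts = trans (sym (map-∘ ts)) (map-cong (evalT-wk ρ u) ts)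

  guard? : ∀ {k} (σ : Env k) (g : Guard k) → Dec (Sat w′ (guardF g) σ)
  guard? σ (t <ᵍ u) = val σ t <? val σ u
  guard? σ (Sᵍ t)   = lookup w′ (evalT σ t) Bool.≟ true

  guard?-wk : ∀ {k} (ρ : Env k) u g → does (guard? (ext ρ u) (wkG g)) ≡ does (guard? ρ g)
  guard?-wk ρ u (t <ᵍ t′) = cong₂ (λ a b → does (a <? b)) (val-wk ρ u t) (val-wk ρ u t′)
  guard?-wk ρ u (Sᵍ t)    = cong (λ x → does (lookup w′ x Bool.≟ true)) (evalT-wk ρ u t)

  select : ∀ {L k} → Env k → Tree L k → L
  select σ (leaf p)     = p
  select σ (node g t e) = if does (guard? σ g) then select σ t else select σ e

  select-yes : ∀ {L k} {σ : Env k} g (t e : Tree L k) →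
               Sat w′ (guardF g) σ → select σ (node g t e) ≡ select σ t
  select-yes {σ = σ} g t e s rewrite dec-true (guard? σ g) s = refl

  select-no : ∀ {L k} {σ : Env k} g (t e : Tree L k) →
              ¬ Sat w′ (guardF g) σ → select σ (node g t e) ≡ select σ e
  select-no {σ = σ} g t e ¬s rewrite dec-false (guard? σ g) ¬s = refl

  select-case : ∀ {L k} {σ : Env k} (R : L → Set) g (t e : Tree L k) →
                (Sat w′ (guardF g) σ → R (select σ t)) → (¬ Sat w′ (guardF g) σ → R (select σ e)) →
                R (select σ (node g t e))
  select-case {σ = σ} R g t e y n with guard? σ g
  ... | yes s = y s
  ... | no ¬s = n ¬s

  select-graft : ∀ {L L′ k} (f : L → Tree L′ (suc k)) (t : Tree L k) ρ u →
                 select (ext ρ u) (graft f t) ≡ select (ext ρ u) (f (select ρ t))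
  select-graft f (leaf p)     ρ u = refl
  select-graft f (node g t e) ρ u rewrite guard?-wk ρ u g with does (guard? ρ g)
  ... | true  = select-graft f t ρ u
  ... | false = select-graft f e ρ u

  -- Weaker than Sat φ σ ⇔ A, whose converse direction would need A to be decidable.
  Decides : ∀ {k} → Set → Formula k → Env k → Set
  Decides A φ σ = (A → Sat w′ φ σ) × (¬ A → ¬ Sat w′ φ σ)

  module Play {P : ℕ → Set} (leafF : ∀ {k} → P k → Formula k)
              (moveA moveE : ∀ {k} → P k → Tree (P (suc k)) (suc k))
              (⟦_⟧ : ∀ {k} → P k → Env k → Set) (Fits : ∀ {k} → List Q → P k → Set)
              (leafF-sound : ∀ {k} {p : P k} {σ} → Fits [] p → Sat w′ (leafF p) σ ⇔ ⟦ p ⟧ σ)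
              (moveA-fits : ∀ {k qs} (p : P k) → Fits (∀q ∷ qs) p → AllLeaves (Fits qs) (moveA p))
              (moveE-fits : ∀ {k qs} (p : P k) → Fits (∃q ∷ qs) p → AllLeaves (Fits qs) (moveE p))
              (moveA-true : ∀ {k} (p : P k) ρ → ⟦ p ⟧ ρ → ∀ u → ⟦ select (ext ρ u) (moveA p) ⟧ (ext ρ u))
              (moveA-false : ∀ {k} (p : P k) ρ → ¬ ⟦ p ⟧ ρ → ∃[ u ] ¬ ⟦ select (ext ρ u) (moveA p) ⟧ (ext ρ u))
              (moveE-true : ∀ {k} (p : P k) ρ → ⟦ p ⟧ ρ → ∃[ v ] ⟦ select (ext ρ v) (moveE p) ⟧ (ext ρ v))
              (moveE-false : ∀ {k} (p : P k) ρ → ¬ ⟦ p ⟧ ρ → ∀ v → ¬ ⟦ select (ext ρ v) (moveE p) ⟧ (ext ρ v))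
              where

    open Game leafF moveA moveE

    treeF-decides : ∀ {k} (t : Tree (P k) k) σ → AllLeaves (Fits []) t → Decides (⟦ select σ t ⟧ σ) (treeF leafF t) σ
    treeF-decides (leaf p) σ fits = from (leafF-sound fits) , λ ¬p s → ¬p (to (leafF-sound fits) s)
    treeF-decides (node g t e) σ (ft , fe) with guard? σ g
    ... | yes s = (λ h → inj₁ (s , proj₁ (treeF-decides t σ ft) h))
                , λ ¬h → λ { (inj₁ (_ , st)) → proj₂ (treeF-decides t σ ft) ¬h st ; (inj₂ (¬s , _)) → ¬s s }
    ... | no ¬s = (λ h → inj₂ (¬s , proj₁ (treeF-decides e σ fe) h))
                , λ ¬h → λ { (inj₁ (s , _)) → ¬s s ; (inj₂ (_ , se)) → proj₂ (treeF-decides e σ fe) ¬h se }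

    game-decides : ∀ {k} qs (t : Tree (P k) k) ρ → AllLeaves (Fits qs) t → Decides (⟦ select ρ t ⟧ ρ) (game qs t) ρ
    game-decides []         t ρ fits = treeF-decides t ρ fits
    game-decides (∀q ∷ qs) t ρ fits =
        (λ h u → proj₁ (next u) (moveA-true _ ρ h u))
      , λ ¬h sat → let (u , ¬h′) = moveA-false _ ρ ¬h in proj₂ (next u) ¬h′ (sat u)
      where
      next : ∀ u → Decides (⟦ select (ext ρ u) (moveA (select ρ t)) ⟧ (ext ρ u)) (game qs (graft moveA t)) (ext ρ u)
      next u = subst (λ p → Decides (⟦ p ⟧ (ext ρ u)) _ _) (select-graft moveA t ρ u)
                 (game-decides qs _ (ext ρ u) (AllLeaves-graft moveA moveA-fits t fits))
    game-decides (∃q ∷ qs) t ρ fits =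
        (λ h → let (v , h′) = moveE-true _ ρ h in v , proj₁ (next v) h′)
      , λ ¬h (v , sat) → proj₂ (next v) (moveE-false _ ρ ¬h v) sat
      where
      next : ∀ v → Decides (⟦ select (ext ρ v) (moveE (select ρ t)) ⟧ (ext ρ v)) (game qs (graft moveE t)) (ext ρ v)
      next v = subst (λ p → Decides (⟦ p ⟧ (ext ρ v)) _ _) (select-graft moveE t ρ v)
                 (game-decides qs _ (ext ρ v) (AllLeaves-graft moveE moveE-fits t fits))

-- The distance game

gap-either : ∀ {P Q a b} → P + (a + b) ≤ Q → ∀ t → P + a ≤ t ⊎ t + suc b ≤ Q
gap-either {P} {Q} {a} {b} h t with P + a ≤? t
... | yes h₁ = inj₁ h₁
... | no ¬h₁ = inj₂ (begin
  t + suc b    ≡⟨ +-suc t b ⟩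
  suc t + b    ≤⟨ +-monoˡ-≤ b (≰⇒> ¬h₁) ⟩
  P + a + b    ≡⟨ +-assoc P a b ⟩
  P + (a + b)  ≤⟨ h ⟩
  Q            ∎)
  where open ≤-Reasoning

gap-join : ∀ {P V Q a b} → P + a ≤ V → V + b ≤ Q → P + (a + b) ≤ Q
gap-join {P} {V} {Q} {a} {b} h₁ h₂ = begin
  P + (a + b)  ≡⟨ +-assoc P a b ⟨
  P + a + b    ≤⟨ +-monoˡ-≤ b h₁ ⟩
  V + b        ≤⟨ h₂ ⟩
  Q            ∎
  where open ≤-Reasoning

gap-refute : ∀ {P Q a b} → P < Q → Q < P + (a + b) → 1 ≤ a → 1 ≤ b →
             ∃[ t ] (P ≤ t × t < Q × t < P + a × Q ≤ t + b)
gap-refute {P} {Q} {suc a} {b} P<Q Q<P+a+b _ 1≤b with P + suc a ≤? Q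
... | yes P+a≤Q = P + a , m≤m+n P a , <-≤-trans (+-monoʳ-< P ≤-refl) P+a≤Q , +-monoʳ-< P ≤-refl
                , ≤-pred (begin-strict
                    Q                  <⟨ Q<P+a+b ⟩
                    P + (suc a + b)    ≡⟨ +-suc P (a + b) ⟩
                    suc (P + (a + b))  ≡⟨ cong suc (+-assoc P a b) ⟨
                    suc (P + a + b)    ∎)
  where open ≤-Reasoning
gap-refute {P} {suc Q} {suc a} {b} P<Q _ _ 1≤b | no P+a≰Q =
  Q , ≤-pred P<Q , ≤-refl , <-trans (n<1+n Q) (≰⇒> P+a≰Q)
  , subst (_≤ Q + b) (+-comm Q 1) (+-monoʳ-≤ Q 1≤b)

P+A≤Q⇒P≤Q : ∀ {P A Q} → P + A ≤ Q → P ≤ Q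
P+A≤Q⇒P≤Q {P} h = m+n≤o⇒m≤o P h

P+1+A≤Q⇒P<Q : ∀ {P A Q} → P + suc A ≤ Q → P < Q
P+1+A≤Q⇒P<Q {P} h = <-≤-trans (m<m+n P (s≤s z≤n)) h

P≤Q⇒P+0≤Q : ∀ {P Q} → P ≤ Q → P + 0 ≤ Q
P≤Q⇒P+0≤Q {P} {Q} h = subst (_≤ Q) (sym (+-identityʳ P)) h

P<Q⇒P+1≤Q : ∀ {P Q} → P < Q → P + 1 ≤ Q
P<Q⇒P+1≤Q {P} {Q} h = subst (_≤ Q) (+-comm 1 P) h

⌈n/2⌉+⌊n/2⌋≡n : ∀ n → ⌈ n /2⌉ + ⌊ n /2⌋ ≡ n
⌈n/2⌉+⌊n/2⌋≡n n = trans (+-comm ⌈ n /2⌉ ⌊ n /2⌋) (⌊n/2⌋+⌈n/2⌉≡n n)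

Splits : ℕ → ℕ → ℕ → ℕ → Set
Splits A X Z U = X ≤ U × U < Z × U < X + ⌈ A /2⌉ × Z ≤ U + ⌊ A /2⌋

splits-exists : ∀ {A X Z} → 2 ≤ A → X < Z → ¬ (X + A ≤ Z) → ∃[ U ] Splits A X Z U
splits-exists {A@(suc (suc _))} {X} {Z} _ X<Z X+A≰Z =
  gap-refute X<Z (subst (λ L → Z < X + L) (sym (⌈n/2⌉+⌊n/2⌋≡n A)) (≰⇒> X+A≰Z)) (s≤s z≤n) (s≤s z≤n)
splits-exists {suc zero} (s≤s ())

⌊n/2⌋<n′ : ∀ {n} → 1 ≤ n → ⌊ n /2⌋ < n
⌊n/2⌋<n′ {suc n} _ = ⌊n/2⌋<n n

1≤⌊n/2⌋ : ∀ {n} → 2 ≤ n → 1 ≤ ⌊ n /2⌋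
1≤⌊n/2⌋ (s≤s (s≤s _)) = s≤s z≤n

-- In code x cs n, x is the element under scrutiny, cs the code values named so far
-- (latest first), and n + 1 values are still to be named.
data Pos (k : ℕ) : Set where
  win lose : Pos k
  both     : Term k → Term k → Term k → ℕ → ℕ → Pos k
  either   : Term k → Term k → Term k → ℕ → ℕ → Pos k
  code     : Term k → List (Term k) → ℕ → Pos k

wkP : ∀ {k} → Pos k → Pos (suc k)
wkP win                = win
wkP lose               = lose
wkP (both x z y A B)   = both (wkT x) (wkT z) (wkT y) A B
wkP (either x z y A B) = either (wkT x) (wkT z) (wkT y) A B
wkP (code x cs n)      = code (wkT x) (map wkT cs) n

trueF falseF : ∀ {k} → Formula k
trueF  = mn ≐ mn
falseF = ¬' trueF

-- Expresses p + A ≤ q only for A ≤ 1; larger gaps never reach the matrix.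
gapF : ∀ {k} → Term k → Term k → ℕ → Formula k
gapF p q zero          = ¬' (q ≺ p)
gapF p q (suc zero)    = p ≺ q
gapF p q (suc (suc _)) = falseF

posF : ∀ {k} → Pos k → Formula k
posF win                = trueF
posF lose               = falseF
posF (both x z y A B)   = gapF x z A ∧' gapF z y B
posF (either x z y A B) = gapF x z A ∨' gapF z y B
posF (code _ _ _)       = falseF

gapF-QF : ∀ {k} (p q : Term k) A → QF (gapF p q A)
gapF-QF p q zero          = qf¬ qf≺
gapF-QF p q (suc zero)    = qf≺
gapF-QF p q (suc (suc _)) = qf¬ qf≐

posF-QF : ∀ {k} (p : Pos k) → QF (posF p)
posF-QF win                = qf≐
posF-QF lose               = qf¬ qf≐
posF-QF (both x z y A B)   = qf∧ (gapF-QF x z A) (gapF-QF z y B)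
posF-QF (either x z y A B) = qf∨ (gapF-QF x z A) (gapF-QF z y B)
posF-QF (code _ _ _)       = qf¬ qf≐

require : ∀ {k} → ℕ → Term k → Term k → Tree (Pos k) k → Tree (Pos k) k
require zero    p q t = node (q <ᵍ p) (leaf lose) t
require (suc _) p q t = node (p <ᵍ q) t (leaf lose)

claim : ∀ {k} → ℕ → Term k → Term k → Tree (Pos k) k → Tree (Pos k) k
claim zero          p q t = node (q <ᵍ p) t (leaf win)
claim (suc zero)    p q t = node (p <ᵍ q) (leaf win) t
claim (suc (suc _)) p q t = t

attack : ∀ {k} → ℕ → Term k → Term k → Term k → Pos k
attack zero             p u q = win
attack (suc zero)       p u q = win
attack A@(suc (suc _)) p u q = either p u q ⌈ A /2⌉ (suc ⌊ A /2⌋)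

defend : ∀ {k} → ℕ → Term k → Term k → Term k → Pos k
defend zero             p v q = lose
defend (suc zero)       p v q = lose
defend A@(suc (suc _)) p v q = both p v q ⌊ A /2⌋ ⌈ A /2⌉

-- ∀ refutes a too small gap by a point too close to both of its ends; ∃ answers an
-- `either` by the midpoint of its true gap. Both halve the gap, and `require`/`claim`
-- settle gaps ≤ 1 by a single comparison.
attackTree : ∀ {k} → Term k → Term k → Term k → Term k → ℕ → ℕ → Tree (Pos k) k
attackTree x z y u A B = node (u <ᵍ z) (leaf (attack A x u z)) (leaf (attack B z u y))

bothMove : ∀ {k} → Term k → Term k → Term k → Term k → ℕ → ℕ → Tree (Pos k) k
bothMove x z y u A B = require A x z (require B z y (attackTree x z y u A B))

defendTree : ∀ {k} → Term k → Term k → Term k → Term k → ℕ → ℕ → Tree (Pos k) k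
defendTree x u y v A B = node (v <ᵍ u) (leaf (defend A x v u)) (node (u <ᵍ v) (leaf (defend B u v y)) (leaf lose))

eitherMove : ∀ {k} → Term k → Term k → Term k → Term k → ℕ → ℕ → Tree (Pos k) k
eitherMove x u y v A B = claim A x u (claim B u y (defendTree x u y v A B))

agree : ∀ {k} → Term k → Bool → Tree (Pos k) k → Tree (Pos k) k
agree x b t = node (Sᵍ x) (if b then t else leaf lose) (if b then leaf lose else t)

-- On code positions a ∀ is a dummy quantifier.
moveA : ∀ {k} → Pos k → Tree (Pos (suc k)) (suc k)
moveA (both x z y A B) = bothMove (wkT x) (wkT z) (wkT y) (var zero) A B
moveA p                = leaf (wkP p)

-- BothFits qs A: every `both` position with gaps ≤ A is settled within the prefix qs.
mutual
  BothFits : List Q → ℕ → Set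
  BothFits []         A = A ≤ 1
  BothFits (∀q ∷ qs) A = EitherFits qs (suc ⌊ A /2⌋)
  BothFits (∃q ∷ qs) A = ⊥

  EitherFits : List Q → ℕ → Set
  EitherFits []         A = A ≤ 1
  EitherFits (∀q ∷ qs) A = ⊥
  EitherFits (∃q ∷ qs) A = BothFits qs ⌈ A /2⌉

mutual
  BothFits-mono : ∀ qs {A A′} → A′ ≤ A → BothFits qs A → BothFits qs A′
  BothFits-mono []         A′≤A h = ≤-trans A′≤A h
  BothFits-mono (∀q ∷ qs) A′≤A h = EitherFits-mono qs (s≤s (⌊n/2⌋-mono A′≤A)) h

  EitherFits-mono : ∀ qs {A A′} → A′ ≤ A → EitherFits qs A → EitherFits qs A′
  EitherFits-mono []         A′≤A h = ≤-trans A′≤A h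
  EitherFits-mono (∃q ∷ qs) A′≤A h = BothFits-mono qs (⌈n/2⌉-mono A′≤A) h

CodeFits : ℕ → List Q → ℕ → Set
CodeFits m []                 n       = ⊥
CodeFits m (∀q ∷ qs)         n       = CodeFits m qs n
CodeFits m (∃q ∷ qs)         zero    = BothFits qs m
CodeFits m (∃q ∷ qs)         (suc n) = CodeFits m qs n

Fits : ℕ → ∀ {k} → List Q → Pos k → Set
Fits m qs win                = ⊤
Fits m qs lose               = ⊤
Fits m qs (both _ _ _ A B)   = BothFits qs A × BothFits qs B
Fits m qs (either _ _ _ A B) = EitherFits qs A × EitherFits qs B
Fits m qs (code _ _ n)       = CodeFits m qs n

module _ {m : ℕ} where

  require-fits : ∀ {k qs} A (p q : Term k) t → AllLeaves (Fits m qs) t → AllLeaves (Fits m qs) (require A p q t)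
  require-fits zero    p q t h = tt , h
  require-fits (suc _) p q t h = h , tt

  claim-fits : ∀ {k qs} A (p q : Term k) t → AllLeaves (Fits m qs) t → AllLeaves (Fits m qs) (claim A p q t)
  claim-fits zero                p q t h = h , tt
  claim-fits (suc zero)          p q t h = tt , h
  claim-fits (suc (suc _))       p q t h = h

  attack-fits : ∀ {k} qs A (p u q : Term k) → EitherFits qs (suc ⌊ A /2⌋) → Fits m qs (attack A p u q)
  attack-fits qs zero             p u q h = tt
  attack-fits qs (suc zero)       p u q h = tt
  attack-fits qs A@(suc (suc _)) p u q h = EitherFits-mono qs (⌊n/2⌋-mono (n≤1+n (suc A))) h , h

  defend-fits : ∀ {k} qs A (p v q : Term k) → BothFits qs ⌈ A /2⌉ → Fits m qs (defend A p v q)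
  defend-fits qs zero             p v q h = tt
  defend-fits qs (suc zero)       p v q h = tt
  defend-fits qs A@(suc (suc _)) p v q h = BothFits-mono qs (⌊n/2⌋≤⌈n/2⌉ A) h , h

  moveA-fits : ∀ {k qs} (p : Pos k) → Fits m (∀q ∷ qs) p → AllLeaves (Fits m qs) (moveA p)
  moveA-fits {qs = qs} (both x z y A B) (hA , hB) =
    require-fits A _ _ _ (require-fits B _ _ _ (attack-fits qs A _ _ _ hA , attack-fits qs B _ _ _ hB))
  moveA-fits win                h = h
  moveA-fits lose               h = h
  moveA-fits (either _ _ _ _ _) (() , _)
  moveA-fits (code _ _ _)       h = h

  eitherMove-fits : ∀ {k} qs (x u y v : Term k) A B → EitherFits (∃q ∷ qs) A → EitherFits (∃q ∷ qs) B →
                    AllLeaves (Fits m qs) (eitherMove x u y v A B)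
  eitherMove-fits qs x u y v A B hA hB =
    claim-fits A _ _ _ (claim-fits B _ _ _ (defend-fits qs A _ _ _ hA , defend-fits qs B _ _ _ hB , tt))

module PosSemantics {m : ℕ} (w′ : Vec Bool (suc m))
                    (Collect : ℕ → Fin (suc m) → List (Fin (suc m)) → Set) where

  open Semantics w′

  Ge : ∀ {k} → Env k → Term k → Term k → ℕ → Set
  Ge σ p q A = val σ p + A ≤ val σ q

  ⟦_⟧ : ∀ {k} → Pos k → Env k → Set
  ⟦ win ⟧              σ = ⊤
  ⟦ lose ⟧             σ = ⊥
  ⟦ both x z y A B ⟧   σ = Ge σ x z A × Ge σ z y B
  ⟦ either x z y A B ⟧ σ = Ge σ x z A ⊎ Ge σ z y B
  ⟦ code x cs n ⟧      σ = Collect n (evalT σ x) (map (evalT σ) cs)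

  Ge-wk : ∀ {k} (ρ : Env k) u p q A → Ge (ext ρ u) (wkT p) (wkT q) A ≡ Ge ρ p q A
  Ge-wk ρ u p q A = cong₂ (λ a b → a + A ≤ b) (val-wk ρ u p) (val-wk ρ u q)

  ⟦⟧-wk : ∀ {k} (p : Pos k) ρ u → ⟦ wkP p ⟧ (ext ρ u) ≡ ⟦ p ⟧ ρ
  ⟦⟧-wk win                ρ u = refl
  ⟦⟧-wk lose               ρ u = refl
  ⟦⟧-wk (both x z y A B)   ρ u = cong₂ _×_ (Ge-wk ρ u x z A) (Ge-wk ρ u z y B)
  ⟦⟧-wk (either x z y A B) ρ u = cong₂ _⊎_ (Ge-wk ρ u x z A) (Ge-wk ρ u z y B)
  ⟦⟧-wk (code x cs n)      ρ u =
    cong₂ (Collect n) (evalT-wk ρ u x) (map-evalT-wk ρ u cs)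

  gapF-sound : ∀ {k} {σ : Env k} p q A → A ≤ 1 → Sat w′ (gapF p q A) σ ⇔ Ge σ p q A
  gapF-sound p q zero       _ = mk⇔ (λ q≮p → P≤Q⇒P+0≤Q (≮⇒≥ q≮p)) (λ h → ≤⇒≯ (P+A≤Q⇒P≤Q h))
  gapF-sound p q (suc zero) _ = mk⇔ P<Q⇒P+1≤Q (P+1+A≤Q⇒P<Q {A = 0})
  gapF-sound p q (suc (suc _)) (s≤s ())

  posF-sound : ∀ {k} {p : Pos k} {σ} → Fits m [] p → Sat w′ (posF p) σ ⇔ ⟦ p ⟧ σ
  posF-sound {p = win}  _ = mk⇔ (λ _ → tt) (λ _ → refl)
  posF-sound {p = lose} _ = mk⇔ (λ f → f refl) λ ()
  posF-sound {p = both x z y A B} (a , b) = gapF-sound x z A a ×-cong gapF-sound z y B b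
  posF-sound {p = either x z y A B} (a , b) = gapF-sound x z A a ⊎-cong gapF-sound z y B b

  require-pass : ∀ {k} {σ : Env k} A p q (t : Tree (Pos k) k) → Ge σ p q A → select σ (require A p q t) ≡ select σ t
  require-pass zero    p q t h = select-no (q <ᵍ p) (leaf lose) t (≤⇒≯ (P+A≤Q⇒P≤Q h))
  require-pass (suc A) p q t h = select-yes (p <ᵍ q) t (leaf lose) (P+1+A≤Q⇒P<Q h)

  require-fail : ∀ {k} {σ : Env k} A p q (t : Tree (Pos k) k) → ¬ Ge σ p q A → ¬ (2 ≤ A × val σ p < val σ q) →
                 select σ (require A p q t) ≡ lose
  require-fail zero          p q t ¬h _     = select-yes (q <ᵍ p) (leaf lose) t (≰⇒> (λ p≤q → ¬h (P≤Q⇒P+0≤Q p≤q)))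
  require-fail (suc zero)    p q t ¬h _     = select-no (p <ᵍ q) t (leaf lose) (λ p<q → ¬h (P<Q⇒P+1≤Q p<q))
  require-fail (suc (suc A)) p q t ¬h ¬near = select-no (p <ᵍ q) t (leaf lose) (λ p<q → ¬near (s≤s (s≤s z≤n) , p<q))

  require-false : ∀ {k} {σ : Env k} A p q (t : Tree (Pos k) k) → ¬ ⟦ select σ t ⟧ σ → ¬ ⟦ select σ (require A p q t) ⟧ σ
  require-false {σ = σ} zero    p q t ¬h = select-case (λ r → ¬ ⟦ r ⟧ σ) (q <ᵍ p) (leaf lose) t (λ _ ()) (λ _ → ¬h)
  require-false {σ = σ} (suc _) p q t ¬h = select-case (λ r → ¬ ⟦ r ⟧ σ) (p <ᵍ q) t (leaf lose) (λ _ → ¬h) (λ _ ())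

  claim-win : ∀ {k} {σ : Env k} A p q (t : Tree (Pos k) k) → A ≤ 1 → Ge σ p q A → select σ (claim A p q t) ≡ win
  claim-win zero          p q t _ h = select-no (q <ᵍ p) t (leaf win) (≤⇒≯ (P+A≤Q⇒P≤Q h))
  claim-win (suc zero)    p q t _ h = select-yes (p <ᵍ q) (leaf win) t (P+1+A≤Q⇒P<Q h)
  claim-win (suc (suc _)) p q t (s≤s ()) h

  claim-pass : ∀ {k} {σ : Env k} A p q (t : Tree (Pos k) k) → ¬ Ge σ p q A → select σ (claim A p q t) ≡ select σ t
  claim-pass zero          p q t ¬h = select-yes (q <ᵍ p) t (leaf win) (≰⇒> (λ p≤q → ¬h (P≤Q⇒P+0≤Q p≤q)))
  claim-pass (suc zero)    p q t ¬h = select-no (p <ᵍ q) (leaf win) t (λ p<q → ¬h (P<Q⇒P+1≤Q p<q))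
  claim-pass (suc (suc _)) p q t ¬h = refl

  claim-true : ∀ {k} {σ : Env k} A p q (t : Tree (Pos k) k) → ⟦ select σ t ⟧ σ → ⟦ select σ (claim A p q t) ⟧ σ
  claim-true {σ = σ} zero       p q t h = select-case (λ r → ⟦ r ⟧ σ) (q <ᵍ p) t (leaf win) (λ _ → h) (λ _ → tt)
  claim-true {σ = σ} (suc zero) p q t h = select-case (λ r → ⟦ r ⟧ σ) (p <ᵍ q) (leaf win) t (λ _ → tt) (λ _ → h)
  claim-true (suc (suc _))      p q t h = h

  ⟦⟧-subst : ∀ {k} {σ : Env k} {r r′ : Pos k} → r ≡ r′ → ⟦ r ⟧ σ → ⟦ r′ ⟧ σ
  ⟦⟧-subst refl h = h

  attack-true : ∀ {k} {σ : Env k} A p u q → Ge σ p q A → ⟦ attack A p u q ⟧ σ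
  attack-true zero             p u q h = tt
  attack-true (suc zero)       p u q h = tt
  attack-true {σ = σ} A@(suc (suc _)) p u q h =
    gap-either {val σ p} {a = ⌈ A /2⌉} {⌊ A /2⌋} (subst (λ L → val σ p + L ≤ val σ q) (sym (⌈n/2⌉+⌊n/2⌋≡n A)) h) (val σ u)

  attack-refuted : ∀ {k} {σ : Env k} A p u q → 2 ≤ A → Splits A (val σ p) (val σ q) (val σ u) → ¬ ⟦ attack A p u q ⟧ σ
  attack-refuted (suc (suc _)) p u q _ (_ , _ , u<p+a , _)   (inj₁ p+a≤u)   = <⇒≱ u<p+a p+a≤u
  attack-refuted {σ = σ} (suc (suc A)) p u q _ (_ , _ , _ , q≤u+b) (inj₂ u+1+b≤q) =
    <⇒≱ (subst (_≤ val σ q) (+-suc (val σ u) _) u+1+b≤q) q≤u+b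
  attack-refuted (suc zero) p u q (s≤s ())

  defend-true : ∀ {k} {σ : Env k} A p v q → 2 ≤ A → val σ v ≡ val σ p + ⌊ A /2⌋ → Ge σ p q A → ⟦ defend A p v q ⟧ σ
  defend-true {σ = σ} A@(suc (suc _)) p v q _ v≡ h =
      ≤-reflexive (sym v≡)
    , (begin
        val σ v + ⌈ A /2⌉               ≡⟨ cong (_+ ⌈ A /2⌉) v≡ ⟩
        val σ p + ⌊ A /2⌋ + ⌈ A /2⌉     ≡⟨ +-assoc (val σ p) _ _ ⟩
        val σ p + (⌊ A /2⌋ + ⌈ A /2⌉)   ≡⟨ cong (val σ p +_) (⌊n/2⌋+⌈n/2⌉≡n A) ⟩
        val σ p + A                     ≤⟨ h ⟩
        val σ q                         ∎)
    where open ≤-Reasoning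
  defend-true (suc zero) p v q (s≤s ())

  defend-false : ∀ {k} {σ : Env k} A p v q → ¬ Ge σ p q A → ¬ ⟦ defend A p v q ⟧ σ
  defend-false {σ = σ} A@(suc (suc _)) p v q ¬h (h₁ , h₂) =
    ¬h (subst (λ L → val σ p + L ≤ val σ q) (⌊n/2⌋+⌈n/2⌉≡n A) (gap-join {val σ p} {a = ⌊ A /2⌋} {⌈ A /2⌉} h₁ h₂))

  attackTree-true : ∀ {k} {σ : Env k} x z y u A B → ⟦ both x z y A B ⟧ σ → ⟦ select σ (attackTree x z y u A B) ⟧ σ
  attackTree-true {σ = σ} x z y u A B (h₁ , h₂) =
    select-case (λ r → ⟦ r ⟧ σ) (u <ᵍ z) (leaf (attack A x u z)) (leaf (attack B z u y))
      (λ _ → attack-true A x u z h₁) (λ _ → attack-true B z u y h₂)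

  attackTree-false-left : ∀ {k} {σ : Env k} x z y u A B → 2 ≤ A → Splits A (val σ x) (val σ z) (val σ u) →
                          ¬ ⟦ select σ (attackTree x z y u A B) ⟧ σ
  attackTree-false-left x z y u A B 2≤A splits@(_ , u<z , _) h =
    attack-refuted A x u z 2≤A splits
      (⟦⟧-subst (select-yes (u <ᵍ z) (leaf (attack A x u z)) (leaf (attack B z u y)) u<z) h)

  attackTree-false-right : ∀ {k} {σ : Env k} x z y u A B → 2 ≤ B → Splits B (val σ z) (val σ y) (val σ u) →
                           ¬ ⟦ select σ (attackTree x z y u A B) ⟧ σ
  attackTree-false-right x z y u A B 2≤B splits@(z≤u , _) h =
    attack-refuted B z u y 2≤B splits
      (⟦⟧-subst (select-no (u <ᵍ z) (leaf (attack A x u z)) (leaf (attack B z u y)) (≤⇒≯ z≤u)) h)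

  bothMove-true : ∀ {k} {σ : Env k} x z y u A B → ⟦ both x z y A B ⟧ σ → ⟦ select σ (bothMove x z y u A B) ⟧ σ
  bothMove-true x z y u A B h@(h₁ , h₂) =
    ⟦⟧-subst (sym (trans (require-pass A x z inner h₁) (require-pass B z y tree h₂))) (attackTree-true x z y u A B h)
    where
    tree  = attackTree x z y u A B
    inner = require B z y tree

  bothMove-false-left : ∀ {k} {σ : Env k} x z y u A B → ¬ Ge σ x z A →
                        (2 ≤ A × val σ x < val σ z → Splits A (val σ x) (val σ z) (val σ u)) →
                        ¬ ⟦ select σ (bothMove x z y u A B) ⟧ σ
  bothMove-false-left {σ = σ} x z y u A B ¬h splits with (2 ≤? A) ×-dec (val σ x <? val σ z)
  ... | no ¬near = λ h → ⟦⟧-subst (require-fail A x z (require B z y (attackTree x z y u A B)) ¬h ¬near) h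
  ... | yes near@(2≤A , _) =
    require-false A x z _ (require-false B z y _ (attackTree-false-left x z y u A B 2≤A (splits near)))

  bothMove-false-right : ∀ {k} {σ : Env k} x z y u A B → ¬ Ge σ z y B →
                         (2 ≤ B × val σ z < val σ y → Splits B (val σ z) (val σ y) (val σ u)) →
                         ¬ ⟦ select σ (bothMove x z y u A B) ⟧ σ
  bothMove-false-right {σ = σ} x z y u A B ¬h splits = require-false A x z _ inner
    where
    inner : ¬ ⟦ select σ (require B z y (attackTree x z y u A B)) ⟧ σ
    inner with (2 ≤? B) ×-dec (val σ z <? val σ y)
    ... | no ¬near = λ h → ⟦⟧-subst (require-fail B z y (attackTree x z y u A B) ¬h ¬near) h
    ... | yes near@(2≤B , _) = require-false B z y _ (attackTree-false-right x z y u A B 2≤B (splits near))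

  defendTree-true-left : ∀ {k} {σ : Env k} x u y v A B → 2 ≤ A → val σ v ≡ val σ x + ⌊ A /2⌋ → Ge σ x u A →
                         ⟦ select σ (defendTree x u y v A B) ⟧ σ
  defendTree-true-left {σ = σ} x u y v A B 2≤A v≡ h =
    ⟦⟧-subst (sym (select-yes (v <ᵍ u) (leaf (defend A x v u)) right v<u)) (defend-true A x v u 2≤A v≡ h)
    where
    v<u : val σ v < val σ u
    v<u = begin-strict
      val σ v            ≡⟨ v≡ ⟩
      val σ x + ⌊ A /2⌋  <⟨ +-monoʳ-< (val σ x) (⌊n/2⌋<n′ (<⇒≤ 2≤A)) ⟩
      val σ x + A        ≤⟨ h ⟩
      val σ u            ∎
      where open ≤-Reasoning
    right = node (u <ᵍ v) (leaf (defend B u v y)) (leaf lose)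

  defendTree-true-right : ∀ {k} {σ : Env k} x u y v A B → 2 ≤ B → val σ v ≡ val σ u + ⌊ B /2⌋ → Ge σ u y B →
                          ⟦ select σ (defendTree x u y v A B) ⟧ σ
  defendTree-true-right {σ = σ} x u y v A B 2≤B v≡ h =
    ⟦⟧-subst (sym (trans (select-no (v <ᵍ u) (leaf (defend A x v u)) right u≤v)
                         (select-yes (u <ᵍ v) (leaf (defend B u v y)) (leaf lose) u<v)))
      (defend-true B u v y 2≤B v≡ h)
    where
    right = node (u <ᵍ v) (leaf (defend B u v y)) (leaf lose)
    u<v : val σ u < val σ v
    u<v = subst (val σ u <_) (sym v≡) (m<m+n (val σ u) (1≤⌊n/2⌋ 2≤B))
    u≤v : ¬ (val σ v < val σ u)
    u≤v = ≤⇒≯ (<⇒≤ u<v)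

  defendTree-false : ∀ {k} {σ : Env k} x u y v A B → ¬ Ge σ x u A → ¬ Ge σ u y B →
                     ¬ ⟦ select σ (defendTree x u y v A B) ⟧ σ
  defendTree-false {σ = σ} x u y v A B ¬h₁ ¬h₂ =
    select-case (λ r → ¬ ⟦ r ⟧ σ) (v <ᵍ u) (leaf (defend A x v u)) right (λ _ → defend-false A x v u ¬h₁)
      (λ _ → select-case (λ r → ¬ ⟦ r ⟧ σ) (u <ᵍ v) (leaf (defend B u v y)) (leaf lose)
               (λ _ → defend-false B u v y ¬h₂) (λ _ ()))
    where right = node (u <ᵍ v) (leaf (defend B u v y)) (leaf lose)

  eitherMove-true-left : ∀ {k} {σ : Env k} x u y v A B → Ge σ x u A → val σ v ≡ val σ x + ⌊ A /2⌋ →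
                         ⟦ select σ (eitherMove x u y v A B) ⟧ σ
  eitherMove-true-left x u y v A B h v≡ with A ≤? 1
  ... | yes A≤1 = ⟦⟧-subst (sym (claim-win A x u (claim B u y (defendTree x u y v A B)) A≤1 h)) tt
  ... | no A≰1  = claim-true A x u _ (claim-true B u y _ (defendTree-true-left x u y v A B (≰⇒> A≰1) v≡ h))

  eitherMove-true-right : ∀ {k} {σ : Env k} x u y v A B → Ge σ u y B → val σ v ≡ val σ u + ⌊ B /2⌋ →
                          ⟦ select σ (eitherMove x u y v A B) ⟧ σ
  eitherMove-true-right x u y v A B h v≡ with B ≤? 1
  ... | yes B≤1 = claim-true A x u _ (⟦⟧-subst (sym (claim-win B u y (defendTree x u y v A B) B≤1 h)) tt)
  ... | no B≰1  = claim-true A x u _ (claim-true B u y _ (defendTree-true-right x u y v A B (≰⇒> B≰1) v≡ h))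

  eitherMove-false : ∀ {k} {σ : Env k} x u y v A B → ¬ Ge σ x u A → ¬ Ge σ u y B →
                     ¬ ⟦ select σ (eitherMove x u y v A B) ⟧ σ
  eitherMove-false x u y v A B ¬h₁ ¬h₂ h =
    defendTree-false x u y v A B ¬h₁ ¬h₂
      (⟦⟧-subst (trans (claim-pass A x u (claim B u y tree) ¬h₁) (claim-pass B u y tree ¬h₂)) h)
    where tree = defendTree x u y v A B

  agree-correct : ∀ {k} (σ : Env k) x b t →
                  ⟦ select σ (agree x b t) ⟧ σ ⇔ (lookup w′ (evalT σ x) ≡ b × ⟦ select σ t ⟧ σ)
  agree-correct σ x b t with lookup w′ (evalT σ x) | b
  ... | true  | true  = mk⇔ (refl ,_) proj₂
  ... | true  | false = mk⇔ (λ ()) (λ ())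
  ... | false | true  = mk⇔ (λ ()) (λ ())
  ... | false | false = mk⇔ (refl ,_) proj₂

  val≤m : ∀ {k} (σ : Env k) t → val σ t ≤ m
  val≤m σ t = ≤-pred (toℕ<n (evalT σ t))

  point : (n : ℕ) → n ≤ m → Fin (suc m)
  point n h = fromℕ< (s≤s h)

  toℕ-point : ∀ n (h : n ≤ m) → toℕ (point n h) ≡ n
  toℕ-point n h = toℕ-fromℕ< (s≤s h)

  splitting-point : ∀ {k} (ρ : Env k) p q A → ¬ Ge ρ p q A →
                    ∃[ u ] (2 ≤ A × val ρ p < val ρ q → Splits A (val ρ p) (val ρ q) (toℕ u))
  splitting-point ρ p q A ¬h with (2 ≤? A) ×-dec (val ρ p <? val ρ q)
  ... | no ¬near = zero , λ near → contradiction near ¬near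
  ... | yes (2≤A , p<q) with splits-exists 2≤A p<q ¬h
  ...   | U , splits@(_ , U<q , _) =
    point U U≤m , λ _ → subst (Splits A (val ρ p) (val ρ q)) (sym (toℕ-point U U≤m)) splits
    where U≤m = ≤-trans (<⇒≤ U<q) (val≤m ρ q)

  ¬Ge-wk : ∀ {k} (ρ : Env k) u p q A → ¬ Ge ρ p q A → ¬ Ge (ext ρ u) (wkT p) (wkT q) A
  ¬Ge-wk ρ u p q A ¬h = subst ¬_ (sym (Ge-wk ρ u p q A)) ¬h

  vals-wk : ∀ {k} (ρ : Env k) u p q (R : ℕ → ℕ → Set) →
            R (val ρ p) (val ρ q) → R (val (ext ρ u) (wkT p)) (val (ext ρ u) (wkT q))
  vals-wk ρ u p q R = subst₂ R (sym (val-wk ρ u p)) (sym (val-wk ρ u q))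

  moveA-true : ∀ {k} (p : Pos k) ρ → ⟦ p ⟧ ρ → ∀ u → ⟦ select (ext ρ u) (moveA p) ⟧ (ext ρ u)
  moveA-true p@(both _ _ _ A B)   ρ h u = bothMove-true _ _ _ (var zero) A B (subst id (sym (⟦⟧-wk p ρ u)) h)
  moveA-true win                  ρ h u = tt
  moveA-true lose                 ρ () u
  moveA-true p@(either _ _ _ _ _) ρ h u = subst id (sym (⟦⟧-wk p ρ u)) h
  moveA-true p@(code _ _ _)       ρ h u = subst id (sym (⟦⟧-wk p ρ u)) h

  moveA-false : ∀ {k} (p : Pos k) ρ → ¬ ⟦ p ⟧ ρ → ∃[ u ] ¬ ⟦ select (ext ρ u) (moveA p) ⟧ (ext ρ u)
  moveA-false (both x z y A B) ρ ¬h with val ρ x + A ≤? val ρ z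
  ... | no ¬h₁ = let (u , splits) = splitting-point ρ x z A ¬h₁ in
    u , bothMove-false-left _ _ _ (var zero) A B (¬Ge-wk ρ u x z A ¬h₁)
          (vals-wk ρ u x z (λ X Z → 2 ≤ A × X < Z → Splits A X Z (toℕ u)) splits)
  ... | yes h₁ = let (u , splits) = splitting-point ρ z y B ¬h₂ in
    u , bothMove-false-right _ _ _ (var zero) A B (¬Ge-wk ρ u z y B ¬h₂)
          (vals-wk ρ u z y (λ X Z → 2 ≤ B × X < Z → Splits B X Z (toℕ u)) splits)
    where ¬h₂ = λ h₂ → ¬h (h₁ , h₂)
  moveA-false lose                ρ ¬h = zero , λ ()
  moveA-false win                 ρ ¬h = zero , λ _ → ¬h tt
  moveA-false p@(either _ _ _ _ _) ρ ¬h = zero , λ h → ¬h (subst id (⟦⟧-wk p ρ zero) h)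
  moveA-false p@(code _ _ _)      ρ ¬h = zero , λ h → ¬h (subst id (⟦⟧-wk p ρ zero) h)

  eitherMove-wk-true : ∀ {k} x u y A B (ρ : Env k) → ⟦ either x u y A B ⟧ ρ →
                       ∃[ v ] ⟦ select (ext ρ v) (eitherMove (wkT x) (wkT u) (wkT y) (var zero) A B) ⟧ (ext ρ v)
  eitherMove-wk-true x u y A B ρ (inj₁ h) =
    v , eitherMove-true-left _ _ _ (var zero) A B (subst id (sym (Ge-wk ρ v x u A)) h)
          (trans (toℕ-point _ v≤m) (cong (_+ ⌊ A /2⌋) (sym (val-wk ρ v x))))
    where
    v≤m = ≤-trans (+-monoʳ-≤ (val ρ x) (⌊n/2⌋≤n A)) (≤-trans h (val≤m ρ u))
    v = point (val ρ x + ⌊ A /2⌋) v≤m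
  eitherMove-wk-true x u y A B ρ (inj₂ h) =
    v , eitherMove-true-right _ _ _ (var zero) A B (subst id (sym (Ge-wk ρ v u y B)) h)
          (trans (toℕ-point _ v≤m) (cong (_+ ⌊ B /2⌋) (sym (val-wk ρ v u))))
    where
    v≤m = ≤-trans (+-monoʳ-≤ (val ρ u) (⌊n/2⌋≤n B)) (≤-trans h (val≤m ρ y))
    v = point (val ρ u + ⌊ B /2⌋) v≤m

  eitherMove-wk-false : ∀ {k} x u y A B (ρ : Env k) → ¬ ⟦ either x u y A B ⟧ ρ →
                        ∀ v → ¬ ⟦ select (ext ρ v) (eitherMove (wkT x) (wkT u) (wkT y) (var zero) A B) ⟧ (ext ρ v)
  eitherMove-wk-false x u y A B ρ ¬h v =
    eitherMove-false _ _ _ (var zero) A B (¬Ge-wk ρ v x u A (¬h ∘ inj₁)) (¬Ge-wk ρ v u y B (¬h ∘ inj₂))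

-- Coding positions by digits and rulers

fromDigits : ℕ → List ℕ → ℕ
fromDigits B []       = 0
fromDigits B (d ∷ ds) = d + B * fromDigits B ds

digits : (B : ℕ) .{{_ : NonZero B}} → ℕ → ℕ → List ℕ
digits B zero    i = []
digits B (suc k) i = i % B ∷ digits B k (i / B)

length-digits : ∀ B .{{_ : NonZero B}} k i → length (digits B k i) ≡ k
length-digits B zero    i = refl
length-digits B (suc k) i = cong suc (length-digits B k (i / B))

digits-< : ∀ B .{{_ : NonZero B}} k i → All (_< B) (digits B k i)
digits-< B zero    i = []
digits-< B (suc k) i = m%n<n i B ∷ digits-< B k (i / B)

fromDigits-digits : ∀ B .{{_ : NonZero B}} k i → i < B ^ k → fromDigits B (digits B k i) ≡ i
fromDigits-digits B zero    zero    _ = refl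
fromDigits-digits B zero    (suc i) (s≤s ())
fromDigits-digits B (suc k) i i<B^k+1 = begin
  i % B + B * fromDigits B (digits B k (i / B))  ≡⟨ cong (λ j → i % B + B * j) (fromDigits-digits B k (i / B) i/B<B^k) ⟩
  i % B + B * (i / B)                            ≡⟨ cong (i % B +_) (*-comm B (i / B)) ⟩
  i % B + i / B * B                              ≡⟨ m≡m%n+[m/n]*n i B ⟨
  i                                              ∎
  where
  open ≡-Reasoning
  i/B<B^k = m<n*o⇒m/o<n (subst (i <_) (*-comm B (B ^ k)) i<B^k+1)

rank : ℕ → List ℕ → ℕ
rank z []       = 0
rank z (r ∷ rs) = if z <ᵇ r then rank z rs else suc (rank z rs)

rulers : ℕ → List ℕ
rulers zero    = []
rulers (suc t) = suc t ∷ rulers t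

rulers-≤ : ∀ t → All (_≤ t) (rulers t)
rulers-≤ zero    = []
rulers-≤ (suc t) = ≤-refl ∷ All.map m≤n⇒m≤1+n (rulers-≤ t)

length-rulers : ∀ t → length (rulers t) ≡ t
length-rulers zero    = refl
length-rulers (suc t) = cong suc (length-rulers t)

rank-rulers-≥ : ∀ z t → t ≤ z → rank z (rulers t) ≡ t
rank-rulers-≥ z zero    _      = refl
rank-rulers-≥ z (suc t) 1+t≤z with z <ᵇ suc t in eq
... | true  = contradiction (<ᵇ⇒< z (suc t) (subst T (sym eq) tt)) (≤⇒≯ 1+t≤z)
... | false = cong suc (rank-rulers-≥ z t (<⇒≤ 1+t≤z))

rank-rulers : ∀ z t → z ≤ t → rank z (rulers t) ≡ z
rank-rulers z zero    z≤0   = sym (n≤0⇒n≡0 z≤0)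
rank-rulers z (suc t) z≤1+t with z <ᵇ suc t in eq
... | true  = rank-rulers z t (≤-pred (<ᵇ⇒< z (suc t) (subst T (sym eq) tt)))
... | false = trans (cong suc (rank-rulers-≥ z t (<⇒≤ 1+t≤z))) (≤-antisym 1+t≤z z≤1+t)
  where
  1+t≤z : suc t ≤ z
  1+t≤z = ≮⇒≥ (λ z<1+t → subst T eq (<⇒<ᵇ z<1+t))

ranks : List ℕ → List ℕ → List ℕ
ranks zs rs = map (λ z → rank z rs) zs

ranks-rulers : ∀ ds t → All (_≤ t) ds → ranks ds (rulers t) ≡ ds
ranks-rulers []       t []         = refl
ranks-rulers (d ∷ ds) t (d≤t ∷ h) = cong₂ _∷_ (rank-rulers d t d≤t) (ranks-rulers ds t h)

take-++ : ∀ {A : Set} {n} (xs ys : List A) → length xs ≡ n → take n (xs ++ ys) ≡ xs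
take-++ []       ys refl = refl
take-++ (x ∷ xs) ys refl = cong (x ∷_) (take-++ xs ys refl)

drop-++ : ∀ {A : Set} {n} (xs ys : List A) → length xs ≡ n → drop n (xs ++ ys) ≡ ys
drop-++ []       ys refl = refl
drop-++ (x ∷ xs) ys refl = drop-++ xs ys refl

∃-toℕ-list : ∀ {n} (xs : List ℕ) → All (_< n) xs → ∃[ vs ] map (toℕ {n}) vs ≡ xs
∃-toℕ-list []       []         = [] , refl
∃-toℕ-list (x ∷ xs) (x<n ∷ h) = let (vs , eq) = ∃-toℕ-list xs h in fromℕ< x<n ∷ vs , cong₂ _∷_ (toℕ-fromℕ< x<n) eq

rankTree : ∀ {L k} → Term k → List (Term k) → (ℕ → Tree L k) → Tree L k
rankTree z []       f = f 0
rankTree z (r ∷ rs) f = node (z <ᵍ r) (rankTree z rs f) (rankTree z rs (f ∘ suc))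

ranksTree : ∀ {L k} → List (Term k) → List (Term k) → (List ℕ → Tree L k) → Tree L k
ranksTree []       rs f = f []
ranksTree (z ∷ zs) rs f = rankTree z rs (λ d → ranksTree zs rs (f ∘ (d ∷_)))

AllLeaves-rankTree : ∀ {L k} {R : L → Set} z rs (f : ℕ → Tree L k) →
                     (∀ d → AllLeaves R (f d)) → AllLeaves R (rankTree z rs f)
AllLeaves-rankTree z []       f h = h 0
AllLeaves-rankTree z (r ∷ rs) f h = AllLeaves-rankTree z rs f h , AllLeaves-rankTree z rs (f ∘ suc) (h ∘ suc)

AllLeaves-ranksTree : ∀ {L k} {R : L → Set} zs rs (f : List ℕ → Tree L k) →
                      (∀ ds → AllLeaves R (f ds)) → AllLeaves R (ranksTree zs rs f)
AllLeaves-ranksTree []       rs f h = h []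
AllLeaves-ranksTree (z ∷ zs) rs f h =
  AllLeaves-rankTree z rs _ (λ d → AllLeaves-ranksTree zs rs (f ∘ (d ∷_)) (h ∘ (d ∷_)))

module _ {m : ℕ} (w′ : Vec Bool (suc m)) where

  open Semantics w′

  select-rankTree : ∀ {L k} (σ : Env k) z rs (f : ℕ → Tree L k) →
                    select σ (rankTree z rs f) ≡ select σ (f (rank (val σ z) (map (val σ) rs)))
  select-rankTree σ z []       f = refl
  select-rankTree σ z (r ∷ rs) f with val σ z <ᵇ val σ r
  ... | true  = select-rankTree σ z rs f
  ... | false = select-rankTree σ z rs (f ∘ suc)

  select-ranksTree : ∀ {L k} (σ : Env k) zs rs (f : List ℕ → Tree L k) →
                     select σ (ranksTree zs rs f) ≡ select σ (f (ranks (map (val σ) zs) (map (val σ) rs)))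
  select-ranksTree σ []       rs f = refl
  select-ranksTree σ (z ∷ zs) rs f =
    trans (select-rankTree σ z rs _) (select-ranksTree σ zs rs (f ∘ (rank (val σ z) (map (val σ) rs) ∷_)))

-- The sentence for a word

lookup-≢ : ∀ {n} {u v : Vec Bool n} → u ≢ v → ∃[ i ] lookup u i ≢ lookup v i
lookup-≢ {n} {u} {v} u≢v = ¬∀⟶∃¬ n _ (λ i → lookup u i Bool.≟ lookup v i)
  (λ same → u≢v (trans (sym (tabulate∘lookup u)) (trans (tabulate-cong same) (tabulate∘lookup v))))

pinned : ∀ {i X m} → i ≤ m → (i ≤ X × X + (m ∸ i) ≤ m) ⇔ X ≡ i
pinned {i} {X} {m} i≤m = mk⇔ to′ (λ { refl → ≤-refl , ≤-reflexive (m+[n∸m]≡n i≤m) })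
  where
  to′ : i ≤ X × X + (m ∸ i) ≤ m → X ≡ i
  to′ (i≤X , h) = ≤-antisym (+-cancelʳ-≤ (m ∸ i) X i (subst (X + (m ∸ i) ≤_) (sym (m+[n∸m]≡n i≤m)) h)) i≤X

module Construction {m : ℕ} (w : Vec Bool (suc m)) (r d : ℕ) where

  -- The first d values are the base-(r + 1) digits, least significant first; each is read
  -- as the number of the remaining r values ("rulers") not exceeding it.
  decode : List ℕ → ℕ
  decode vs = fromDigits (suc r) (ranks (take d vs) (drop d vs))

  decodeTree : ∀ {L k} → List (Term k) → (ℕ → Tree L k) → Tree L k
  decodeTree cs f = ranksTree (take d cs) (drop d cs) (f ∘ fromDigits (suc r))

  letterTree : ∀ {k} → Term k → ℕ → Tree (Pos k) k
  letterTree x i with i <? suc m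
  ... | no _    = leaf lose
  ... | yes i<n = agree x (lookup w (fromℕ< i<n)) (leaf (both mn x mx i (m ∸ i)))

  moveE : ∀ {k} → Pos k → Tree (Pos (suc k)) (suc k)
  moveE (either x u y A B)  = eitherMove (wkT x) (wkT u) (wkT y) (var zero) A B
  moveE (code x cs zero)    = decodeTree (var zero ∷ map wkT cs) (letterTree (wkT x))
  moveE (code x cs (suc n)) = leaf (code (wkT x) (var zero ∷ map wkT cs) n)
  moveE p                   = leaf (wkP p)

  open Game posF moveA moveE

  sentence : List Q → ℕ → Sentence
  sentence qs n = ∀' (game qs (leaf (code (var zero) [] n)))

  qr-sentence : ∀ qs n → qr (sentence qs n) ≡ suc (length qs)
  qr-sentence qs n = cong suc (qr-game posF-QF qs _)

  prefix-sentence : ∀ qs n → prefix (sentence qs n) ≡ ∀q ∷ qs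
  prefix-sentence qs n = cong (∀q ∷_) (prefix-game posF-QF qs _)

  prenex-sentence : ∀ qs n → Prenex (sentence qs n)
  prenex-sentence qs n = p∀ (prenex-game posF-QF qs _)

  letterTree-fits : ∀ {k} qs (x : Term k) i → BothFits qs m → AllLeaves (Fits m qs) (letterTree x i)
  letterTree-fits qs x i h with i <? suc m
  ... | no _    = tt
  ... | yes i<n with lookup w (fromℕ< i<n)
  ...   | true  = (BothFits-mono qs (≤-pred i<n) h , BothFits-mono qs (m∸n≤m m i) h) , tt
  ...   | false = tt , (BothFits-mono qs (≤-pred i<n) h , BothFits-mono qs (m∸n≤m m i) h)

  moveE-fits : ∀ {k qs} (p : Pos k) → Fits m (∃q ∷ qs) p → AllLeaves (Fits m qs) (moveE p)
  moveE-fits {qs = qs} (either x u y A B) (hA , hB) = eitherMove-fits qs _ _ _ _ A B hA hB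
  moveE-fits {qs = qs} (code x cs zero)   h = AllLeaves-ranksTree (take d cs′) (drop d cs′) _
                                                (λ ds → letterTree-fits qs (wkT x) (fromDigits (suc r) ds) h)
    where cs′ = var zero ∷ map wkT cs
  moveE-fits (code x cs (suc n)) h = h
  moveE-fits win                 h = h
  moveE-fits lose                h = h
  moveE-fits (both _ _ _ _ _)    (() , _)

  module Meaning (w′ : Vec Bool (suc m)) where

    open Semantics w′

    LetterOK : Fin (suc m) → ℕ → Set
    LetterOK xv i = toℕ xv ≡ i × lookup w′ xv ≡ lookup w xv

    Collect : ℕ → Fin (suc m) → List (Fin (suc m)) → Set
    Collect zero    xv vs = ∃[ v ] LetterOK xv (decode (map toℕ (v ∷ vs)))
    Collect (suc n) xv vs = ∃[ v ] Collect n xv (v ∷ vs)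

    open PosSemantics w′ Collect

    select-decodeTree : ∀ {L k} (σ : Env k) cs (f : ℕ → Tree L k) →
                        select σ (decodeTree cs f) ≡ select σ (f (decode (map (val σ) cs)))
    select-decodeTree σ cs f =
      trans (select-ranksTree w′ σ (take d cs) (drop d cs) _)
            (cong (λ ds → select σ (f (fromDigits (suc r) ds))) (sym (cong₂ ranks (take-map d cs) (drop-map d cs))))

    letterTree-correct : ∀ {k} (σ : Env k) x i → ⟦ select σ (letterTree x i) ⟧ σ ⇔ LetterOK (evalT σ x) i
    letterTree-correct σ x i with i <? suc m
    ... | no i≮n = mk⇔ (λ ()) (λ (x≡i , _) → i≮n (subst (_< suc m) x≡i (toℕ<n (evalT σ x))))
    ... | yes i<n = mk⇔
      (λ h → let (agrees , i≤x , x≤) = to (agree-correct σ x b at) h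
                 x≡i = to (pinned (≤-pred i<n)) (i≤x , subst (val σ x + (m ∸ i) ≤_) (toℕ-fromℕ m) x≤)
             in x≡i , trans agrees (cong (lookup w) (fromℕ<≡ x≡i)))
      (λ (x≡i , agrees) → let (i≤x , x≤) = from (pinned (≤-pred i<n)) x≡i in
         from (agree-correct σ x b at)
           ( trans agrees (cong (lookup w) (sym (fromℕ<≡ x≡i)))
           , i≤x , subst (val σ x + (m ∸ i) ≤_) (sym (toℕ-fromℕ m)) x≤))
      where
      b  = lookup w (fromℕ< i<n)
      at = leaf (both mn x mx i (m ∸ i))
      fromℕ<≡ : val σ x ≡ i → fromℕ< i<n ≡ evalT σ x
      fromℕ<≡ x≡i = toℕ-injective (trans (toℕ-fromℕ< i<n) (sym x≡i))

    lastCode-correct : ∀ {k} (ρ : Env k) x cs v →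
      ⟦ select (ext ρ v) (moveE (code x cs zero)) ⟧ (ext ρ v) ⇔
      LetterOK (evalT ρ x) (decode (map toℕ (v ∷ map (evalT ρ) cs)))
    lastCode-correct ρ x cs v =
      subst₂ (λ p xv → ⟦ p ⟧ σ ⇔ LetterOK xv i) (sym select≡) (evalT-wk ρ v x) (letterTree-correct σ (wkT x) i)
      where
      σ = ext ρ v
      i = decode (map toℕ (v ∷ map (evalT ρ) cs))
      vals≡ : map (val σ) (var zero ∷ map wkT cs) ≡ map toℕ (v ∷ map (evalT ρ) cs)
      vals≡ = cong (toℕ v ∷_) (trans (map-∘ (map wkT cs)) (cong (map toℕ) (map-evalT-wk ρ v cs)))
      select≡ : select σ (moveE (code x cs zero)) ≡ select σ (letterTree (wkT x) i)
      select≡ = trans (select-decodeTree σ (var zero ∷ map wkT cs) (letterTree (wkT x)))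
                      (cong (λ vs → select σ (letterTree (wkT x) (decode vs))) vals≡)

    nextCode-wk : ∀ {k} (ρ : Env k) x cs n v →
      ⟦ code (wkT x) (var zero ∷ map wkT cs) n ⟧ (ext ρ v) ≡ Collect n (evalT ρ x) (v ∷ map (evalT ρ) cs)
    nextCode-wk ρ x cs n v = cong₂ (λ xv vs → Collect n xv (v ∷ vs)) (evalT-wk ρ v x) (map-evalT-wk ρ v cs)

    moveE-true : ∀ {k} (p : Pos k) ρ → ⟦ p ⟧ ρ → ∃[ v ] ⟦ select (ext ρ v) (moveE p) ⟧ (ext ρ v)
    moveE-true (either x u y A B)  ρ h       = eitherMove-wk-true x u y A B ρ h
    moveE-true (code x cs zero)    ρ (v , h) = v , from (lastCode-correct ρ x cs v) h
    moveE-true (code x cs (suc n)) ρ (v , h) = v , subst id (sym (nextCode-wk ρ x cs n v)) h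
    moveE-true win                 ρ h       = zero , tt
    moveE-true p@(both _ _ _ _ _)  ρ h       = zero , subst id (sym (⟦⟧-wk p ρ zero)) h

    moveE-false : ∀ {k} (p : Pos k) ρ → ¬ ⟦ p ⟧ ρ → ∀ v → ¬ ⟦ select (ext ρ v) (moveE p) ⟧ (ext ρ v)
    moveE-false (either x u y A B)  ρ ¬h   = eitherMove-wk-false x u y A B ρ ¬h
    moveE-false (code x cs zero)    ρ ¬h v = λ h → ¬h (v , to (lastCode-correct ρ x cs v) h)
    moveE-false (code x cs (suc n)) ρ ¬h v = λ h → ¬h (v , subst id (nextCode-wk ρ x cs n v) h)
    moveE-false win                 ρ ¬h v = λ _ → ¬h tt
    moveE-false lose                ρ ¬h v = λ ()
    moveE-false p@(both _ _ _ _ _)  ρ ¬h v = λ h → ¬h (subst id (⟦⟧-wk p ρ v) h)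

    open Play posF moveA moveE ⟦_⟧ (Fits m) posF-sound moveA-fits moveE-fits
              moveA-true moveA-false moveE-true moveE-false

    sentence-decides : ∀ qs n → CodeFits m qs n → ∀ x₀ →
                       Decides (Collect n x₀ []) (game qs (leaf (code (var zero) [] n))) (ext noVars x₀)
    sentence-decides qs n fits x₀ = game-decides qs (leaf (code (var zero) [] n)) (ext noVars x₀) fits

  open Meaning using (LetterOK; Collect; sentence-decides)

  Collect-none : ∀ w′ n xv vs → lookup w′ xv ≢ lookup w xv → ¬ Collect w′ n xv vs
  Collect-none w′ zero    xv vs w′≢w (_ , _ , agrees) = w′≢w agrees
  Collect-none w′ (suc n) xv vs w′≢w (v , h)           = Collect-none w′ n xv (v ∷ vs) w′≢w h

  Collect-intro : ∀ n xv ps (vs : List (Fin (suc m))) → length vs ≡ suc n →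
                  LetterOK w xv (decode (map toℕ (reverseAcc ps vs))) → Collect w n xv ps
  Collect-intro zero    xv ps (v ∷ [])     _   h = v , h
  Collect-intro (suc n) xv ps (v ∷ vs)     len h = v , Collect-intro n xv (v ∷ ps) vs (suc-injective len) h
  Collect-intro zero    xv ps (_ ∷ _ ∷ _) ()
  Collect-intro _       xv ps []           ()

  decode-digits : ∀ i → i < suc r ^ d → decode (digits (suc r) d i ++ rulers r) ≡ i
  decode-digits i i< = begin
    fromDigits (suc r) (ranks (take d (ds ++ rulers r)) (drop d (ds ++ rulers r)))
      ≡⟨ cong₂ (λ a b → fromDigits (suc r) (ranks a b)) (take-++ ds _ |ds|≡d) (drop-++ ds _ |ds|≡d) ⟩
    fromDigits (suc r) (ranks ds (rulers r))
      ≡⟨ cong (fromDigits (suc r)) (ranks-rulers ds r (All.map ≤-pred (digits-< (suc r) d i))) ⟩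
    fromDigits (suc r) ds
      ≡⟨ fromDigits-digits (suc r) d i i< ⟩
    i ∎
    where
    open ≡-Reasoning
    ds = digits (suc r) d i
    |ds|≡d = length-digits (suc r) d i

  Collect-complete : r ≤ m → m < suc r ^ d → ∀ n → suc n ≡ d + r → ∀ x₀ → Collect w n x₀ []
  Collect-complete r≤m m<B^d n |code|≡ x₀ =
    Collect-intro n x₀ [] (reverse vs) |vs|≡
      (subst (λ us → LetterOK w x₀ (decode (map toℕ us))) (sym (reverse-involutive vs)) (sym decoded , refl))
    where
    i = toℕ x₀
    values = digits (suc r) d i ++ rulers r
    bounded : All (_< suc m) values
    bounded = All.++⁺ (All.map (λ d<B → ≤-trans d<B (s≤s r≤m)) (digits-< (suc r) d i))
                      (All.map (λ r′≤r → s≤s (≤-trans r′≤r r≤m)) (rulers-≤ r))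
    vs = proj₁ (∃-toℕ-list values bounded)
    decoded : decode (map toℕ vs) ≡ i
    decoded = trans (cong decode (proj₂ (∃-toℕ-list values bounded))) (decode-digits i (<-≤-trans (toℕ<n x₀) m<B^d))
    |vs|≡ : length (reverse vs) ≡ suc n
    |vs|≡ = begin
      length (reverse vs)                              ≡⟨ length-reverse vs ⟩
      length vs                                        ≡⟨ length-map toℕ vs ⟨
      length (map toℕ vs)                              ≡⟨ cong length (proj₂ (∃-toℕ-list values bounded)) ⟩
      length values                                    ≡⟨ length-++ (digits (suc r) d i) ⟩
      length (digits (suc r) d i) + length (rulers r)  ≡⟨ cong₂ _+_ (length-digits (suc r) d i) (length-rulers r) ⟩
      d + r                                            ≡⟨ |code|≡ ⟨
      suc n                                            ∎
      where open ≡-Reasoning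

  sentence-identifies : ∀ qs n → CodeFits m qs n → r ≤ m → m < suc r ^ d → suc n ≡ d + r →
                        (w ⊨ sentence qs n) × (∀ w′ → w′ ≢ w → ¬ (w′ ⊨ sentence qs n))
  sentence-identifies qs n fits r≤m m<B^d |code|≡ =
      (λ x₀ → proj₁ (sentence-decides w qs n fits x₀) (Collect-complete r≤m m<B^d n |code|≡ x₀))
    , λ w′ w′≢w sat → let (x₀ , differ) = lookup-≢ w′≢w in
        proj₂ (sentence-decides w′ qs n fits x₀) (Collect-none w′ n x₀ [] differ) (sat x₀)

-- Counting quantifiers

log-bracket : ∀ B → 2 ≤ B → ∀ n → ∃[ d ] (n < B ^ d × B ^ pred d ≤ suc n)
log-bracket B 2≤B zero    = 0 , s≤s z≤n , s≤s z≤n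
log-bracket B 2≤B (suc n) with log-bracket B 2≤B n
... | d , n<B^d , B^d-1≤1+n with suc n <? B ^ d
...   | yes 1+n<B^d = d , 1+n<B^d , m≤n⇒m≤1+n B^d-1≤1+n
...   | no  1+n≮B^d = suc d , 1+n<B^1+d , ≤-trans (≤-reflexive B^d≡1+n) (n≤1+n (suc n))
  where
  B^d≡1+n : B ^ d ≡ suc n
  B^d≡1+n = ≤-antisym (≮⇒≥ 1+n≮B^d) n<B^d
  1+n<B^1+d : suc n < B * B ^ d
  1+n<B^1+d = subst (λ x → suc n < B * x) (sym B^d≡1+n)
                (subst (_< B * suc n) (*-identityˡ (suc n)) (*-monoˡ-< (suc n) 2≤B))

+-∸-≤ : ∀ m n o → (m + n) ∸ o ≤ m + (n ∸ o)
+-∸-≤ m n       zero    = ≤-refl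
+-∸-≤ m zero    (suc o) = m∸n≤m (m + 0) (suc o)
+-∸-≤ m (suc n) (suc o) rewrite +-suc m n = +-∸-≤ m n o

≤log+C-mono : ∀ {n C C′} x → C ≤ C′ → ≤log+C n C x → ≤log+C n C′ x
≤log+C-mono x C≤C′ h = ≤-trans (^-monoʳ-≤ 2 (∸-monoʳ-≤ x C≤C′)) h

≤log+C-intro : ∀ {N C} x j → x + 3 ≤ C → 2 ^ pred j ≤ N → ≤log+C N C (x + (2 + j))
≤log+C-intro {N} {C} x j x+3≤C h =
  ≤-trans (^-monoʳ-≤ 2 (≤-trans (∸-monoʳ-≤ (x + (2 + j)) x+3≤C) (≤-reflexive ([m+n]∸[m+o]≡n∸o x (2 + j) 3)))) h

qr-≤[1+ε]log+C : ∀ {a b N C} e l → ≤εlog+1 a b N e → ≤log+C N C l → ≤[1+ε]log+C a b N (2 + C) (suc (e + l))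
qr-≤[1+ε]log+C {a} {b} {N} {C} e l he hl = begin
  2 ^ (b * ((e + l) ∸ suc C))                ≤⟨ ^-monoʳ-≤ 2 (*-monoʳ-≤ b (split e)) ⟩
  2 ^ (b * ((e ∸ 1) + (l ∸ C)))              ≡⟨ cong (2 ^_) (*-distribˡ-+ b (e ∸ 1) (l ∸ C)) ⟩
  2 ^ (b * (e ∸ 1) + b * (l ∸ C))            ≡⟨ ^-distribˡ-+-* 2 (b * (e ∸ 1)) (b * (l ∸ C)) ⟩
  2 ^ (b * (e ∸ 1)) * 2 ^ (b * (l ∸ C))      ≡⟨ cong (λ x → 2 ^ (b * (e ∸ 1)) * 2 ^ x) (*-comm b (l ∸ C)) ⟩
  2 ^ (b * (e ∸ 1)) * 2 ^ ((l ∸ C) * b)      ≡⟨ cong (2 ^ (b * (e ∸ 1)) *_) (^-*-assoc 2 (l ∸ C) b) ⟨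
  2 ^ (b * (e ∸ 1)) * (2 ^ (l ∸ C)) ^ b      ≤⟨ *-mono-≤ he (^-monoˡ-≤ b hl) ⟩
  N ^ a * N ^ b                              ≡⟨ ^-distribˡ-+-* N a b ⟨
  N ^ (a + b)                                ∎
  where
  open ≤-Reasoning
  split : ∀ e → (e + l) ∸ suc C ≤ (e ∸ 1) + (l ∸ C)
  split zero    = ∸-monoʳ-≤ l (n≤1+n C)
  split (suc e) = +-∸-≤ e l C

≤εlog+1-intro : ∀ a b p m → suc (2 ^ (2 * b)) ≤ p → (2 + 2 ^ (2 * b)) ^ p ≤ suc m →
                ≤εlog+1 (suc a) b (suc m) (suc (2 ^ (2 * b)) + suc p)
≤εlog+1-intro a b p m 1+c≤p B^p≤1+m = begin
  2 ^ (b * (c + suc p))  ≤⟨ ^-monoʳ-≤ 2 (*-monoʳ-≤ b c+1+p≤p+p) ⟩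
  2 ^ (b * (p + p))      ≡⟨ cong (2 ^_) (double b p) ⟩
  2 ^ (2 * b * p)        ≡⟨ ^-*-assoc 2 (2 * b) p ⟨
  c ^ p                  ≤⟨ ^-monoˡ-≤ p (m≤n+m c 2) ⟩
  (2 + c) ^ p            ≤⟨ B^p≤1+m ⟩
  suc m                  ≤⟨ m≤m*n (suc m) (suc m ^ a) {{>-nonZero (m^n>0 (suc m) a)}} ⟩
  suc m ^ suc a          ∎
  where
  open ≤-Reasoning
  c = 2 ^ (2 * b)
  c+1+p≤p+p : c + suc p ≤ p + p
  c+1+p≤p+p = subst (_≤ p + p) (sym (+-suc c p)) (+-monoˡ-≤ p 1+c≤p)
  double : ∀ b p → b * (p + p) ≡ 2 * b * p
  double = solve-∀

dual : Q → Q
dual ∀q = ∃q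
dual ∃q = ∀q

alternating : Q → ℕ → List Q
alternating q zero    = []
alternating q (suc r) = q ∷ alternating (dual q) r

Alternating-alternating : ∀ q r → Alternating (alternating q r)
Alternating-alternating q zero          = alt[]
Alternating-alternating q (suc zero)    = alt[ q ]
Alternating-alternating q (suc (suc r)) = alt∷ (q≢dual q) (Alternating-alternating (dual q) (suc r))
  where
  q≢dual : ∀ q → q ≢ dual q
  q≢dual ∀q ()
  q≢dual ∃q ()

length-alternating : ∀ q r → length (alternating q r) ≡ r
length-alternating q zero    = refl
length-alternating q (suc r) = cong suc (length-alternating (dual q) r)

interleaved∃ : ℕ → List Q
interleaved∃ zero    = ∃q ∷ []
interleaved∃ (suc n) = ∃q ∷ ∀q ∷ interleaved∃ n

interleaved-++ : ∀ n r → interleaved∃ n ++ alternating ∀q r ≡ alternating ∃q (suc (n + n) + r)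
interleaved-++ zero    r = refl
interleaved-++ (suc n) r =
  cong (λ qs → ∃q ∷ ∀q ∷ qs) (trans (interleaved-++ n r) (cong (λ k → alternating ∃q (k + r)) (sym (+-suc n n))))

⌊1+n+n/2⌋≡n : ∀ n → ⌊ suc (n + n) /2⌋ ≡ n
⌊1+n+n/2⌋≡n zero    = refl
⌊1+n+n/2⌋≡n (suc n) = cong suc (trans (cong ⌊_/2⌋ (+-suc n n)) (⌊1+n+n/2⌋≡n n))

fits-alternating : ∀ j A → A ≤ suc (2 ^ j) →
                   BothFits (alternating ∀q (2 + j)) A × EitherFits (alternating ∃q (2 + j)) A
fits-alternating zero    zero                   _ = s≤s z≤n , s≤s z≤n
fits-alternating zero    (suc zero)             _ = s≤s z≤n , s≤s z≤n
fits-alternating zero    (suc (suc zero))       _ = s≤s z≤n , s≤s z≤n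
fits-alternating zero    (suc (suc (suc _)))    (s≤s (s≤s ()))
fits-alternating (suc j) A A≤ =
    proj₂ (fits-alternating j (suc ⌊ A /2⌋) (s≤s ⌊A/2⌋≤))
  , proj₁ (fits-alternating j ⌈ A /2⌉ (≤-trans (⌊n/2⌋-mono (n≤1+n (suc A))) (s≤s ⌊A/2⌋≤)))
  where
  ⌊A/2⌋≤ : ⌊ A /2⌋ ≤ 2 ^ j
  ⌊A/2⌋≤ = ≤-trans (⌊n/2⌋-mono (subst (A ≤_) (cong (λ k → suc (2 ^ j + k)) (+-identityʳ (2 ^ j))) A≤))
                   (≤-reflexive (⌊1+n+n/2⌋≡n (2 ^ j)))

∃-gap-prefix : ∀ m → ∃[ j ] (BothFits (alternating ∀q (2 + j)) m × 2 ^ pred j ≤ suc m)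
∃-gap-prefix m =
  let (j , m<2^j , 2^j-1≤1+m) = log-bracket 2 ≤-refl m
  in j , proj₁ (fits-alternating j m (≤-trans (<⇒≤ m<2^j) (n≤1+n _))) , 2^j-1≤1+m

CodeFits-replicate : ∀ {m} n G → BothFits G m → CodeFits m (replicate (suc n) ∃q ++ G) n
CodeFits-replicate zero    G h = h
CodeFits-replicate (suc n) G h = CodeFits-replicate n G h

CodeFits-interleaved : ∀ {m} n G → BothFits G m → CodeFits m (interleaved∃ n ++ G) n
CodeFits-interleaved zero    G h = h
CodeFits-interleaved (suc n) G h = CodeFits-interleaved n G h

OneVsAll : (a b C m : ℕ) → Vec Bool (suc m) → Set
OneVsAll a b C m w = ∃[ φ ] ((w ⊨ φ) × ((w′ : Vec Bool (suc m)) → w′ ≢ w → ¬ (w′ ⊨ φ))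
    × ≤[1+ε]log+C (suc a) (suc b) (suc m) C (qr φ)
    × Prenex φ
    × ∃[ es ] ∃[ alt ] ((prefix φ ≡ ∀q ∷ (es ++ alt))
        × All (_≡ ∃q) es × ≤εlog+1 (suc a) (suc b) (suc m) (length es)
        × Alternating alt × ≤log+C (suc m) C (length alt)))

module Parameters (a b : ℕ) where

  -- (c + 2)^(d - 1) ≤ n then gives 2^((b + 1)(d + c)) ≤ n^(a + 1) as soon as d > c + 1.
  c : ℕ
  c = 2 ^ (2 * suc b)

  M₀ : ℕ
  M₀ = (2 + c) ^ suc c

  Cₐ : ℕ
  Cₐ = 2 + (M₀ + M₀)

  3≤Cₐ : 3 ≤ Cₐ
  3≤Cₐ = s≤s (s≤s (≤-trans (m^n>0 (2 + c) (suc c)) (m≤m+n M₀ M₀)))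

  record Plan (m : ℕ) : Set where
    field
      r d n          : ℕ
      es alt         : List Q
      r≤m            : r ≤ m
      m<base^d       : m < suc r ^ d
      code-length    : suc n ≡ d + r
      fits           : CodeFits m (es ++ alt) n
      es-∃           : All (_≡ ∃q) es
      es-short       : ≤εlog+1 (suc a) (suc b) (suc m) (length es)
      alt-alternates : Alternating alt
      alt-short      : ≤log+C (suc m) Cₐ (length alt)

  large-plan : ∀ m d → suc c < d → m < (2 + c) ^ d → (2 + c) ^ pred d ≤ suc m → Plan m
  large-plan m (suc p) (s≤s 1+c≤p) m<B^d B^p≤1+m = record
    { r = suc c ; d = suc p ; n = c + suc p
    ; es = replicate (suc c + suc p) ∃q ; alt = alternating ∀q (2 + j)
    ; r≤m = ≤-pred (≤-trans (subst (_≤ (2 + c) ^ p) (*-identityʳ (2 + c)) (^-monoʳ-≤ (2 + c) 1≤p)) B^p≤1+m)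
    ; m<base^d = m<B^d
    ; code-length = +-comm (suc c) (suc p)
    ; fits = CodeFits-replicate (c + suc p) _ gaps-fit
    ; es-∃ = All.replicate⁺ (suc c + suc p) refl
    ; es-short = subst (≤εlog+1 (suc a) (suc b) (suc m)) (sym (length-replicate (suc c + suc p)))
                   (≤εlog+1-intro a (suc b) p m 1+c≤p B^p≤1+m)
    ; alt-alternates = Alternating-alternating ∀q (2 + j)
    ; alt-short = subst (≤log+C (suc m) Cₐ) (sym (length-alternating ∀q (2 + j)))
                    (≤log+C-intro 0 j 3≤Cₐ 2^j-1≤1+m)
    }
    where
    1≤p = ≤-trans (s≤s z≤n) 1+c≤p
    j = proj₁ (∃-gap-prefix m)
    gaps-fit = proj₁ (proj₂ (∃-gap-prefix m))
    2^j-1≤1+m = proj₂ (proj₂ (∃-gap-prefix m))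

  -- Below M₀ the m + 1 code quantifiers are interleaved with dummy ∀s and counted in the
  -- alternating part, whose constant Cₐ absorbs them.
  small-plan : ∀ m → m < M₀ → Plan m
  small-plan m m<M₀ = record
    { r = m ; d = 1 ; n = m
    ; es = [] ; alt = interleaved∃ m ++ alternating ∀q (2 + j)
    ; r≤m = ≤-refl
    ; m<base^d = subst (m <_) (sym (*-identityʳ (suc m))) ≤-refl
    ; code-length = refl
    ; fits = CodeFits-interleaved m _ gaps-fit
    ; es-∃ = []
    ; es-short = subst (λ e → 2 ^ e ≤ suc m ^ suc a) (sym (*-zeroʳ (suc b))) (m^n>0 (suc m) (suc a))
    ; alt-alternates = subst Alternating (sym (interleaved-++ m (2 + j)))
                         (Alternating-alternating ∃q (suc (m + m) + (2 + j)))
    ; alt-short = subst (≤log+C (suc m) Cₐ)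
                    (sym (trans (cong length (interleaved-++ m (2 + j))) (length-alternating ∃q (suc (m + m) + (2 + j)))))
                    (≤log+C-intro (suc (m + m)) j 1+2m+3≤Cₐ 2^j-1≤1+m)
    }
    where
    j = proj₁ (∃-gap-prefix m)
    gaps-fit = proj₁ (proj₂ (∃-gap-prefix m))
    2^j-1≤1+m = proj₂ (proj₂ (∃-gap-prefix m))
    1+2m+3≤Cₐ : suc (m + m) + 3 ≤ Cₐ
    1+2m+3≤Cₐ = subst (_≤ Cₐ) (shift m) (+-monoʳ-≤ 2 (+-mono-≤ m<M₀ m<M₀))
      where
      shift : ∀ m → 2 + (suc m + suc m) ≡ suc (m + m) + 3
      shift = solve-∀

  plan : ∀ m → Plan m
  plan m with log-bracket (2 + c) (s≤s (s≤s z≤n)) m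
  ... | d , m<B^d , B^d-1≤1+m with suc c <? d
  ...   | yes 1+c<d = large-plan m d 1+c<d m<B^d B^d-1≤1+m
  ...   | no  1+c≮d = small-plan m (<-≤-trans m<B^d (^-monoʳ-≤ (2 + c) (≮⇒≥ 1+c≮d)))

  identify : ∀ m (w : Vec Bool (suc m)) → Plan m → OneVsAll a b (2 + Cₐ) m w
  identify m w P =
      sentence qs n , proj₁ identifies , proj₂ identifies
    , subst (≤[1+ε]log+C (suc a) (suc b) (suc m) (2 + Cₐ)) (sym qr≡)
        (qr-≤[1+ε]log+C {suc a} {suc b} {suc m} {Cₐ} (length es) (length alt) es-short alt-short)
    , prenex-sentence qs n
    , es , alt , prefix-sentence qs n , es-∃ , es-short
    , alt-alternates , ≤log+C-mono (length alt) (m≤n+m Cₐ 2) alt-short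
    where
    open Plan P
    open Construction w r d
    qs = es ++ alt
    identifies = sentence-identifies qs n fits r≤m m<base^d code-length
    qr≡ : qr (sentence qs n) ≡ suc (length es + length alt)
    qr≡ = trans (qr-sentence qs n) (cong suc (length-++ es))

theorem5p3 : (a b : ℕ) → ∃[ C ] ((m : ℕ) → (w : Vec Bool (suc m)) →
    ∃[ φ ] ((w ⊨ φ) × ((w' : Vec Bool (suc m)) → w' ≢ w → ¬ (w' ⊨ φ))
      × ≤[1+ε]log+C (suc a) (suc b) (suc m) C (qr φ)
      × Prenex φ
      × ∃[ es ] ∃[ alt ] ((prefix φ ≡ ∀q ∷ (es ++ alt))
          × All (_≡ ∃q) es × ≤εlog+1 (suc a) (suc b) (suc m) (length es)
          × Alternating alt × ≤log+C (suc m) C (length alt))))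
theorem5p3 a b = 2 + Cₐ , λ m w → identify m w (plan m)
  where open Parameters a b
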